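{- As $n\to\infty$, \[ \max\{|\rho_{n,0}|,|\rho_{n,3}|\}\le 2^{8n+o(n)}. \]
   Context: $|\cdot|$ is the usual absolute value. $(a)_m=a(a+1)\cdots(a+m-1)$. For $n\ge0$ let $R_n(t)=2^{8n}(2t+n)\frac{(t+1/2)_n^4}{(t)_{n+1}^4}$ with partial-fraction decomposition $R_n(t)=\sum_{i=1}^4\sum_{k=0}^n \frac{r_{n,i,k}}{(t+k)^i}$, $r_{n,i,k}\in\mathbb{Q}$, and let \[ \rho_{n,0}=-\sum_{i=1}^{4}\sum_{k=0}^{n}\sum_{\ell=1}^{k}\frac{i(i+1)\,r_{n,i,k}}{(\ell-1/2)^{i+2}},\qquad \rho_{n,3}=384\sum_{k=0}^{n}r_{n,3,k} \] (empty sum for $k=0$ is $0$). -}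

module Defs where

open import Data.Nat as ℕ using (ℕ; zero; suc)
open import Data.Rational
open import Data.Rational.Properties using (_≟_)
open import Relation.Nullary using (yes; no)
open import Data.Integer using (+_)
open import Relation.Binary.PropositionalEquality using (_≡_; _≢_)

_^ℚ_ : ℚ → ℕ → ℚ
p ^ℚ zero = 1ℚ
p ^ℚ suc m = p * (p ^ℚ m)

-- total inverse: 1/p for p ≠ 0, and 0 at 0 (only ever used at nonzero arguments)
inv : ℚ → ℚ
inv p with p ≟ 0ℚ
... | yes _ = 0ℚ
... | no p≢0 = 1/_ p {{≢-nonZero p≢0}}

ι : ℕ → ℚ
ι n = (+ n) / 1

-- Σ_{k=a}^{b} f k   (empty if b < a), via Σ_{j=0}^{m-1} f (a + j)
Σ< : ℕ → (ℕ → ℚ) → ℚ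
Σ< zero f = 0ℚ
Σ< (suc m) f = Σ< m f + f m

Σ[_to_] : ℕ → ℕ → (ℕ → ℚ) → ℚ
Σ[ a to b ] f = Σ< (suc b ℕ.∸ a) (λ j → f (a ℕ.+ j))

Π< : ℕ → (ℕ → ℚ) → ℚ
Π< zero f = 1ℚ
Π< (suc m) f = Π< m f * f m

poch : ℚ → ℕ → ℚ
poch a m = Π< m (λ j → a + ι j)

half : ℚ
half = (+ 1) / 2

R : ℕ → ℚ → ℚ
R n t = (ι 2 ^ℚ (8 ℕ.* n)) * (ι 2 * t + ι n) * (poch (t + half) n ^ℚ 4)
          * inv (poch t (suc n) ^ℚ 4)

IsPartialFractionOfR : ℕ → (ℕ → ℕ → ℚ) → Set
IsPartialFractionOfR n r =
  ∀ (t : ℚ) → (∀ k → k ℕ.≤ n → t + ι k ≢ 0ℚ) →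
  R n t ≡ Σ[ 1 to 4 ] (λ i → Σ[ 0 to n ] (λ k → r i k * inv ((t + ι k) ^ℚ i)))

ρ0 : (ℕ → ℕ → ℚ) → ℕ → ℚ
ρ0 r n = - Σ[ 1 to 4 ] (λ i → Σ[ 0 to n ] (λ k → Σ[ 1 to k ] (λ ℓ →
           ι (i ℕ.* (i ℕ.+ 1)) * r i k * inv ((ι ℓ - half) ^ℚ (i ℕ.+ 2)))))

ρ3 : (ℕ → ℕ → ℚ) → ℕ → ℚ
ρ3 r n = ι 384 * Σ[ 0 to n ] (λ k → r 3 k)

-- Write t = ε - k with 0 < |ε| ≤ 1/2 and k ≤ n.  Pairing each factor of (t + 1/2)_n with a factor
-- of (t)_{n+1} that is at least as large in absolute value leaves the factor t + k = ε over, so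
-- |ε (t + 1/2)_n| ≤ |(t)_{n+1}| and |ε⁴ R_n(t)| ≤ 2^{8n} · 3(n+1).  In the partial-fraction expansion
-- of ε⁴ R_n(ε - k) the terms with pole -k form the cubic Σ_i r_{n,i,k} ε^{4-i}, and all other terms
-- are at most 16 ε⁴ Σ|r| since their poles are at distance ≥ 1/2.  Finite differences at ε = ±a, ±2a
-- therefore bound a^{4-i} |r_{n,i,k}| by 2^{8n} n + a⁴ Σ|r| up to constants; for a = 1/(4096(n+1))
-- the error can be absorbed, so Σ|r_{n,i,k}| = O(n⁵ 2^{8n}).  Finally |ρ_{n,0}|, |ρ_{n,3}| are
-- O(n Σ|r_{n,i,k}|), and the polynomial factor is 2^{o(n)}.

module Submission where

open import Defs

module Growth where
  open import Data.Nat
  open import Data.Nat.Properties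
  open import Data.Nat.DivMod
  open import Data.Product using (∃-syntax; _,_)
  open import Relation.Binary.PropositionalEquality
  open import Data.Nat.Tactic.RingSolver using (solve-∀)

  n<2^n : ∀ n → n < 2 ^ n
  n<2^n zero    = s≤s z≤n
  n<2^n (suc n) = +-mono-≤ (m^n>0 2 n) (≤-trans (n<2^n n) (m≤m+n (2 ^ n) 0))

  ^-distribʳ-* : ∀ m n e → (m * n) ^ e ≡ m ^ e * n ^ e
  ^-distribʳ-* m n zero    = refl
  ^-distribʳ-* m n (suc e) = begin
    m * n * (m * n) ^ e     ≡⟨ cong (m * n *_) (^-distribʳ-* m n e) ⟩
    m * n * (m ^ e * n ^ e) ≡⟨ interchange m n (m ^ e) (n ^ e) ⟩
    m * m ^ e * (n * n ^ e) ∎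
    where
    open ≡-Reasoning
    interchange : ∀ a b c d → a * b * (c * d) ≡ a * c * (b * d)
    interchange = solve-∀

  -- With D = 2(e+1) and q = ⌊n / D⌋: n + 1 ≤ D 2^q, q (e+1) ≤ n, and A D^e ≤ q < 2^q once n ≥ A D^e D.
  eventually-poly≤2^n : ∀ A e → ∃[ N ] (∀ n → N ≤ n → A * suc n ^ e ≤ 2 ^ n)
  eventually-poly≤2^n A e = A * D ^ e * D , bound
    where
    D : ℕ
    D = 2 * suc e
    bound : ∀ n → A * D ^ e * D ≤ n → A * suc n ^ e ≤ 2 ^ n
    bound n N≤n = begin
      A * suc n ^ e              ≤⟨ *-monoʳ-≤ A (^-monoˡ-≤ e sn≤D*2^q) ⟩
      A * (D * 2 ^ q) ^ e        ≡⟨ cong (A *_) (^-distribʳ-* D (2 ^ q) e) ⟩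
      A * (D ^ e * (2 ^ q) ^ e)  ≡⟨ sym (*-assoc A (D ^ e) ((2 ^ q) ^ e)) ⟩
      A * D ^ e * (2 ^ q) ^ e    ≤⟨ *-monoˡ-≤ ((2 ^ q) ^ e) (≤-trans AD^e≤q (<⇒≤ (n<2^n q))) ⟩
      2 ^ q * (2 ^ q) ^ e        ≡⟨ cong (2 ^ q *_) (^-*-assoc 2 q e) ⟩
      2 ^ q * 2 ^ (q * e)        ≡⟨ sym (^-distribˡ-+-* 2 q (q * e)) ⟩
      2 ^ (q + q * e)            ≤⟨ ^-monoʳ-≤ 2 q[1+e]≤n ⟩
      2 ^ n                      ∎
      where
      open ≤-Reasoning
      q = n / D
      AD^e≤q : A * D ^ e ≤ q
      AD^e≤q = subst (_≤ q) (m*n/n≡m (A * D ^ e) D) (/-monoˡ-≤ D N≤n)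
      sn≤D*2^q : suc n ≤ D * 2 ^ q
      sn≤D*2^q = begin
        suc n              ≡⟨ cong suc (m≡m%n+[m/n]*n n D) ⟩
        suc (n % D + q * D) ≤⟨ +-monoˡ-≤ (q * D) (m%n<n n D) ⟩
        D + q * D          ≡⟨ *-comm (suc q) D ⟩
        D * suc q          ≤⟨ *-monoʳ-≤ D (n<2^n q) ⟩
        D * 2 ^ q          ∎
      q[1+e]≤n : q + q * e ≤ n
      q[1+e]≤n = begin
        q + q * e    ≡⟨ sym (*-suc q e) ⟩
        q * suc e    ≤⟨ *-monoʳ-≤ q (m≤n*m (suc e) 2) ⟩
        q * D        ≤⟨ m/n*n≤m n D ⟩
        n            ∎

  eventually-[poly*2^cn]^p≤2^[cp+1]n : ∀ C d c p →
    ∃[ N ] (∀ n → N ≤ n → (C * suc n ^ d * 2 ^ (c * n)) ^ p ≤ 2 ^ ((c * p + 1) * n))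
  eventually-[poly*2^cn]^p≤2^[cp+1]n C d c p with eventually-poly≤2^n (C ^ p) (d * p)
  ... | N , poly≤2^n = N , bound
    where
    bound : ∀ n → N ≤ n → (C * suc n ^ d * 2 ^ (c * n)) ^ p ≤ 2 ^ ((c * p + 1) * n)
    bound n N≤n = begin
      (C * suc n ^ d * 2 ^ (c * n)) ^ p             ≡⟨ ^-distribʳ-* (C * suc n ^ d) (2 ^ (c * n)) p ⟩
      (C * suc n ^ d) ^ p * (2 ^ (c * n)) ^ p        ≡⟨ cong₂ _*_ (^-distribʳ-* C (suc n ^ d) p) (^-*-assoc 2 (c * n) p) ⟩
      C ^ p * (suc n ^ d) ^ p * 2 ^ (c * n * p)      ≡⟨ cong (λ x → C ^ p * x * 2 ^ (c * n * p)) (^-*-assoc (suc n) d p) ⟩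
      C ^ p * suc n ^ (d * p) * 2 ^ (c * n * p)      ≤⟨ *-monoˡ-≤ (2 ^ (c * n * p)) (poly≤2^n n N≤n) ⟩
      2 ^ n * 2 ^ (c * n * p)                        ≡⟨ sym (^-distribˡ-+-* 2 n (c * n * p)) ⟩
      2 ^ (n + c * n * p)                            ≡⟨ cong (2 ^_) (exponent c p n) ⟩
      2 ^ ((c * p + 1) * n)                          ∎
      where
      open ≤-Reasoning
      exponent : ∀ c p n → n + c * n * p ≡ (c * p + 1) * n
      exponent = solve-∀

module Estimates where
  open import Data.Nat as ℕ using (ℕ; zero; suc)
  import Data.Nat.Properties as ℕP
  import Data.Integer as ℤ
  import Data.Integer.Properties as ℤP
  open import Data.Rational
  open import Data.Rational.Properties
  import Data.Rational.Unnormalised as ℚᵘ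
  import Data.Rational.Unnormalised.Properties as ℚᵘP
  open import Data.Rational.Solver using (module +-*-Solver)
  open +-*-Solver using (solve; Polynomial; con; _:+_; _:*_; _:-_; :-_; _:^_; _:=_)
  open import Algebra.Bundles using (CommutativeMonoid)
  open import Algebra.Properties.CommutativeSemigroup
    (CommutativeMonoid.commutativeSemigroup *-1-commutativeMonoid)
    using () renaming (interchange to *-interchange; x∙yz≈y∙xz to *-exchangeˡ; xy∙z≈xz∙y to *-exchangeʳ)
  open import Data.Sum using (inj₁; inj₂)
  open import Data.Product using (_×_; _,_)
  open import Relation.Binary.Definitions using (tri<; tri≈; tri>)
  open import Data.Empty using (⊥-elim)
  open import Relation.Nullary using (yes; no; ¬_)
  open import Relation.Binary.PropositionalEquality
  open import Data.Nat.Tactic.RingSolver using (solve-∀)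

  ι-suc : ∀ n → ι (suc n) ≡ 1ℚ + ι n
  ι-suc n = toℚᵘ-injective (begin
    toℚᵘ (ι (suc n))          ≈⟨ toℚᵘ-fromℚᵘ (n/1 (suc n)) ⟩
    n/1 (suc n)               ≈⟨ ℚᵘ.*≡* (cong (ℤ._* ℤ.+ 1) numerator) ⟩
    ℚᵘ.1ℚᵘ ℚᵘ.+ n/1 n         ≈⟨ ℚᵘP.+-cong (toℚᵘ-fromℚᵘ ℚᵘ.1ℚᵘ) (toℚᵘ-fromℚᵘ (n/1 n)) ⟨
    toℚᵘ 1ℚ ℚᵘ.+ toℚᵘ (ι n)   ≈⟨ toℚᵘ-homo-+ 1ℚ (ι n) ⟨
    toℚᵘ (1ℚ + ι n)           ∎)
    where
    open ℚᵘP.≃-Reasoning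
    n/1 : ℕ → ℚᵘ.ℚᵘ
    n/1 m = ℚᵘ.mkℚᵘ (ℤ.+ m) 0
    numerator : ℤ.+ suc n ≡ ℤ.+ 1 ℤ.* ℤ.+ 1 ℤ.+ ℤ.+ n ℤ.* ℤ.+ 1
    numerator = sym (cong (ℤ._+_ (ℤ.+ 1)) (ℤP.*-identityʳ (ℤ.+ n)))

  ι-+ : ∀ a b → ι (a ℕ.+ b) ≡ ι a + ι b
  ι-+ zero    b = sym (+-identityˡ (ι b))
  ι-+ (suc a) b = begin
    ι (suc (a ℕ.+ b))  ≡⟨ ι-suc (a ℕ.+ b) ⟩
    1ℚ + ι (a ℕ.+ b)   ≡⟨ cong (1ℚ +_) (ι-+ a b) ⟩
    1ℚ + (ι a + ι b)   ≡⟨ sym (+-assoc 1ℚ (ι a) (ι b)) ⟩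
    (1ℚ + ι a) + ι b   ≡⟨ cong (_+ ι b) (sym (ι-suc a)) ⟩
    ι (suc a) + ι b    ∎
    where open ≡-Reasoning

  ι-* : ∀ a b → ι (a ℕ.* b) ≡ ι a * ι b
  ι-* zero    b = sym (*-zeroˡ (ι b))
  ι-* (suc a) b = begin
    ι (b ℕ.+ a ℕ.* b)        ≡⟨ ι-+ b (a ℕ.* b) ⟩
    ι b + ι (a ℕ.* b)        ≡⟨ cong₂ _+_ (sym (*-identityˡ (ι b))) (ι-* a b) ⟩
    1ℚ * ι b + ι a * ι b     ≡⟨ sym (*-distribʳ-+ (ι b) 1ℚ (ι a)) ⟩
    (1ℚ + ι a) * ι b         ≡⟨ cong (_* ι b) (sym (ι-suc a)) ⟩
    ι (suc a) * ι b          ∎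
    where open ≡-Reasoning

  ι-^ : ∀ a e → ι (a ℕ.^ e) ≡ ι a ^ℚ e
  ι-^ a zero    = refl
  ι-^ a (suc e) = trans (ι-* a (a ℕ.^ e)) (cong (ι a *_) (ι-^ a e))

  p≤p+q : ∀ {p q} → 0ℚ ≤ q → p ≤ p + q
  p≤p+q {p} {q} 0≤q = ≤-trans (≤-reflexive (sym (+-identityʳ p))) (+-monoʳ-≤ p 0≤q)

  +-nonNeg : ∀ {p q} → 0ℚ ≤ p → 0ℚ ≤ q → 0ℚ ≤ p + q
  +-nonNeg 0≤p 0≤q = ≤-trans 0≤p (p≤p+q 0≤q)

  *-nonNeg : ∀ {p q} → 0ℚ ≤ p → 0ℚ ≤ q → 0ℚ ≤ p * q
  *-nonNeg {p} {q} 0≤p 0≤q =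
    nonNegative⁻¹ (p * q) {{nonNeg*nonNeg⇒nonNeg p {{nonNegative 0≤p}} q {{nonNegative 0≤q}}}}

  *-mono-≤-nonNeg : ∀ {p q r s} → 0ℚ ≤ p → 0ℚ ≤ r → p ≤ q → r ≤ s → p * r ≤ q * s
  *-mono-≤-nonNeg {p} {q} {r} {s} 0≤p 0≤r p≤q r≤s =
    ≤-trans (*-monoʳ-≤-nonNeg r {{nonNegative 0≤r}} p≤q)
            (*-monoˡ-≤-nonNeg q {{nonNegative (≤-trans 0≤p p≤q)}} r≤s)

  ι-nonNeg : ∀ n → 0ℚ ≤ ι n
  ι-nonNeg n = nonNegative⁻¹ (ι n) {{normalize-nonNeg n 1}}

  ι-mono-≤ : ∀ {a b} → a ℕ.≤ b → ι a ≤ ι b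
  ι-mono-≤ {a} {b} a≤b = begin
    ι a                   ≤⟨ p≤p+q (ι-nonNeg (b ℕ.∸ a)) ⟩
    ι a + ι (b ℕ.∸ a)     ≡⟨ sym (ι-+ a (b ℕ.∸ a)) ⟩
    ι (a ℕ.+ (b ℕ.∸ a))   ≡⟨ cong ι (ℕP.m+[n∸m]≡n a≤b) ⟩
    ι b                   ∎
    where open ≤-Reasoning

  ι-∸ : ∀ {m n} → n ℕ.≤ m → ι m ≡ ι (m ℕ.∸ n) + ι n
  ι-∸ {m} {n} n≤m = trans (cong ι (sym (ℕP.m∸n+n≡m n≤m))) (ι-+ (m ℕ.∸ n) n)

  ∣ι*p∣≡ι*∣p∣ : ∀ n p → ∣ ι n * p ∣ ≡ ι n * ∣ p ∣
  ∣ι*p∣≡ι*∣p∣ n p = trans (∣p*q∣≡∣p∣*∣q∣ (ι n) p) (cong (_* ∣ p ∣) (0≤p⇒∣p∣≡p (ι-nonNeg n)))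

  neg-involutive : ∀ p → - (- p) ≡ p
  neg-involutive = solve 1 (λ p → :- (:- p) := p) refl

  p≤∣p∣ : ∀ p → p ≤ ∣ p ∣
  p≤∣p∣ p with ≤-total 0ℚ p
  ... | inj₁ 0≤p = ≤-reflexive (sym (0≤p⇒∣p∣≡p 0≤p))
  ... | inj₂ p≤0 = ≤-trans p≤0 (0≤∣p∣ p)

  ∣p∣≤q⇒p≤q : ∀ {p q} → ∣ p ∣ ≤ q → p ≤ q
  ∣p∣≤q⇒p≤q {p} = ≤-trans (p≤∣p∣ p)

  ∣p∣≤q⇒-q≤p : ∀ {p q} → ∣ p ∣ ≤ q → - q ≤ p
  ∣p∣≤q⇒-q≤p {p} {q} ∣p∣≤q = subst (- q ≤_) (neg-involutive p)
    (neg-antimono-≤ (∣p∣≤q⇒p≤q (subst (_≤ q) (sym (∣-p∣≡∣p∣ p)) ∣p∣≤q)))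

  -q≤p≤q⇒∣p∣≤q : ∀ {p q} → - q ≤ p → p ≤ q → ∣ p ∣ ≤ q
  -q≤p≤q⇒∣p∣≤q {p} {q} -q≤p p≤q with ∣p∣≡p∨∣p∣≡-p p
  ... | inj₁ ∣p∣≡p  = subst (_≤ q) (sym ∣p∣≡p) p≤q
  ... | inj₂ ∣p∣≡-p = subst₂ _≤_ (sym ∣p∣≡-p) (neg-involutive q) (neg-antimono-≤ -q≤p)

  ½≤1 : half ≤ 1ℚ
  ½≤1 = ≤ᵇ⇒≤ _

  p-q+q≡p : ∀ p q → p - q + q ≡ p
  p-q+q≡p = solve 2 (λ p q → p :- q :+ q := p) refl

  p-q≤p : ∀ {p q} → 0ℚ ≤ q → p - q ≤ p
  p-q≤p {p} {q} 0≤q = ≤-trans (p≤p+q 0≤q) (≤-reflexive (p-q+q≡p p q))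

  ^ℚ-+ : ∀ x a b → x ^ℚ (a ℕ.+ b) ≡ x ^ℚ a * x ^ℚ b
  ^ℚ-+ x zero    b = sym (*-identityˡ (x ^ℚ b))
  ^ℚ-+ x (suc a) b = trans (cong (x *_) (^ℚ-+ x a b)) (sym (*-assoc x (x ^ℚ a) (x ^ℚ b)))

  ^ℚ-distrib-* : ∀ x y m → (x * y) ^ℚ m ≡ x ^ℚ m * y ^ℚ m
  ^ℚ-distrib-* x y zero    = refl
  ^ℚ-distrib-* x y (suc m) =
    trans (cong (x * y *_) (^ℚ-distrib-* x y m)) (*-interchange x y (x ^ℚ m) (y ^ℚ m))

  ∣^ℚ∣ : ∀ x m → ∣ x ^ℚ m ∣ ≡ ∣ x ∣ ^ℚ m
  ∣^ℚ∣ x zero    = refl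
  ∣^ℚ∣ x (suc m) = trans (∣p*q∣≡∣p∣*∣q∣ x (x ^ℚ m)) (cong (∣ x ∣ *_) (∣^ℚ∣ x m))

  ^ℚ-nonNeg : ∀ {x} m → 0ℚ ≤ x → 0ℚ ≤ x ^ℚ m
  ^ℚ-nonNeg zero    _   = ≤ᵇ⇒≤ _
  ^ℚ-nonNeg (suc m) 0≤x = *-nonNeg 0≤x (^ℚ-nonNeg m 0≤x)

  ^ℚ-mono-≤ : ∀ {x y} m → 0ℚ ≤ x → x ≤ y → x ^ℚ m ≤ y ^ℚ m
  ^ℚ-mono-≤ zero    _   _   = ≤-refl
  ^ℚ-mono-≤ (suc m) 0≤x x≤y = *-mono-≤-nonNeg 0≤x (^ℚ-nonNeg m 0≤x) x≤y (^ℚ-mono-≤ m 0≤x x≤y)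

  1^ℚ : ∀ m → 1ℚ ^ℚ m ≡ 1ℚ
  1^ℚ zero    = refl
  1^ℚ (suc m) = trans (*-identityˡ (1ℚ ^ℚ m)) (1^ℚ m)

  ^ℚ-antimonoʳ : ∀ {x i j} → 0ℚ ≤ x → x ≤ 1ℚ → i ℕ.≤ j → x ^ℚ j ≤ x ^ℚ i
  ^ℚ-antimonoʳ {x} {i} {j} 0≤x x≤1 i≤j = begin
    x ^ℚ j                      ≡⟨ cong (x ^ℚ_) (sym (ℕP.m+[n∸m]≡n i≤j)) ⟩
    x ^ℚ (i ℕ.+ (j ℕ.∸ i))      ≡⟨ ^ℚ-+ x i (j ℕ.∸ i) ⟩
    x ^ℚ i * x ^ℚ (j ℕ.∸ i)     ≤⟨ *-monoˡ-≤-nonNeg (x ^ℚ i) {{nonNegative (^ℚ-nonNeg i 0≤x)}} x^[j-i]≤1 ⟩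
    x ^ℚ i * 1ℚ                 ≡⟨ *-identityʳ (x ^ℚ i) ⟩
    x ^ℚ i                      ∎
    where
    open ≤-Reasoning
    x^[j-i]≤1 : x ^ℚ (j ℕ.∸ i) ≤ 1ℚ
    x^[j-i]≤1 = ≤-trans (^ℚ-mono-≤ (j ℕ.∸ i) 0≤x x≤1) (≤-reflexive (1^ℚ (j ℕ.∸ i)))

  inv-inverseˡ : ∀ {y} → y ≢ 0ℚ → inv y * y ≡ 1ℚ
  inv-inverseˡ {y} y≢0 with y ≟ 0ℚ
  ... | yes y≡0 = ⊥-elim (y≢0 y≡0)
  ... | no  y≢0 = *-inverseˡ y {{≢-nonZero y≢0}}

  inv-cancelʳ : ∀ {y} z → y ≢ 0ℚ → z * y * inv y ≡ z
  inv-cancelʳ {y} z y≢0 = begin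
    z * y * inv y      ≡⟨ *-assoc z y (inv y) ⟩
    z * (y * inv y)    ≡⟨ cong (z *_) (trans (*-comm y (inv y)) (inv-inverseˡ y≢0)) ⟩
    z * 1ℚ             ≡⟨ *-identityʳ z ⟩
    z                  ∎
    where open ≡-Reasoning

  *-nonZero : ∀ {x y} → x ≢ 0ℚ → y ≢ 0ℚ → x * y ≢ 0ℚ
  *-nonZero {x} {y} x≢0 y≢0 xy≡0 = x≢0 (begin
    x                ≡⟨ sym (inv-cancelʳ x y≢0) ⟩
    x * y * inv y    ≡⟨ cong (_* inv y) xy≡0 ⟩
    0ℚ * inv y       ≡⟨ *-zeroˡ (inv y) ⟩
    0ℚ               ∎)
    where open ≡-Reasoning

  ^ℚ-nonZero : ∀ {x} m → x ≢ 0ℚ → x ^ℚ m ≢ 0ℚ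
  ^ℚ-nonZero zero    _   ()
  ^ℚ-nonZero (suc m) x≢0 = *-nonZero x≢0 (^ℚ-nonZero m x≢0)

  ^ℚ-*-inv : ∀ {x i m} → x ≢ 0ℚ → i ℕ.≤ m → x ^ℚ m * inv (x ^ℚ i) ≡ x ^ℚ (m ℕ.∸ i)
  ^ℚ-*-inv {x} {i} {m} x≢0 i≤m = begin
    x ^ℚ m * inv (x ^ℚ i)                    ≡⟨ cong (λ e → x ^ℚ e * inv (x ^ℚ i)) (sym (ℕP.m∸n+n≡m i≤m)) ⟩
    x ^ℚ (m ℕ.∸ i ℕ.+ i) * inv (x ^ℚ i)      ≡⟨ cong (_* inv (x ^ℚ i)) (^ℚ-+ x (m ℕ.∸ i) i) ⟩
    x ^ℚ (m ℕ.∸ i) * x ^ℚ i * inv (x ^ℚ i)   ≡⟨ inv-cancelʳ (x ^ℚ (m ℕ.∸ i)) (^ℚ-nonZero i x≢0) ⟩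
    x ^ℚ (m ℕ.∸ i)                           ∎
    where open ≡-Reasoning

  ∣inv∣≤ : ∀ {y D} → 0ℚ ≤ D → 1ℚ ≤ D * ∣ y ∣ → ∣ inv y ∣ ≤ D
  ∣inv∣≤ {y} {D} 0≤D 1≤D∣y∣ with y ≟ 0ℚ
  ... | yes refl = 0≤D
  ... | no  y≢0  = begin
    ∣ inv′ ∣                    ≡⟨ sym (*-identityʳ ∣ inv′ ∣) ⟩
    ∣ inv′ ∣ * 1ℚ               ≤⟨ *-monoˡ-≤-nonNeg ∣ inv′ ∣ {{∣-∣-nonNeg inv′}} 1≤D∣y∣ ⟩
    ∣ inv′ ∣ * (D * ∣ y ∣)      ≡⟨ cong (∣ inv′ ∣ *_) (*-comm D ∣ y ∣) ⟩
    ∣ inv′ ∣ * (∣ y ∣ * D)      ≡⟨ sym (*-assoc ∣ inv′ ∣ ∣ y ∣ D) ⟩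
    ∣ inv′ ∣ * ∣ y ∣ * D        ≡⟨ cong (_* D) (sym (∣p*q∣≡∣p∣*∣q∣ inv′ y)) ⟩
    ∣ inv′ * y ∣ * D            ≡⟨ cong (λ z → ∣ z ∣ * D) (*-inverseˡ y {{≢-nonZero y≢0}}) ⟩
    1ℚ * D                      ≡⟨ *-identityˡ D ⟩
    D                           ∎
    where
    open ≤-Reasoning
    inv′ = 1/_ y {{≢-nonZero y≢0}}

  -- No hypothesis y ≢ 0 is needed since inv 0ℚ = 0ℚ.
  ∣*inv∣≤1 : ∀ {x y} → ∣ x ∣ ≤ ∣ y ∣ → ∣ x * inv y ∣ ≤ 1ℚ
  ∣*inv∣≤1 {x} {y} ∣x∣≤∣y∣ with y ≟ 0ℚ
  ... | yes _   = ≤-trans (≤-reflexive (cong ∣_∣ (*-zeroʳ x))) (≤ᵇ⇒≤ _)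
  ... | no  y≢0 = begin
    ∣ x * inv′ ∣          ≡⟨ ∣p*q∣≡∣p∣*∣q∣ x inv′ ⟩
    ∣ x ∣ * ∣ inv′ ∣      ≤⟨ *-monoʳ-≤-nonNeg ∣ inv′ ∣ {{∣-∣-nonNeg inv′}} ∣x∣≤∣y∣ ⟩
    ∣ y ∣ * ∣ inv′ ∣      ≡⟨ sym (∣p*q∣≡∣p∣*∣q∣ y inv′) ⟩
    ∣ y * inv′ ∣          ≡⟨ cong ∣_∣ (*-inverseʳ y {{≢-nonZero y≢0}}) ⟩
    1ℚ                    ∎
    where
    open ≤-Reasoning
    inv′ = 1/_ y {{≢-nonZero y≢0}}

  ∣inv[y^e]∣≤2^e : ∀ {y} e → half ≤ ∣ y ∣ → ∣ inv (y ^ℚ e) ∣ ≤ ι 2 ^ℚ e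
  ∣inv[y^e]∣≤2^e {y} e ½≤∣y∣ = ∣inv∣≤ (^ℚ-nonNeg e (ι-nonNeg 2)) (begin
    1ℚ                          ≡⟨ sym (1^ℚ e) ⟩
    1ℚ ^ℚ e                     ≤⟨ ^ℚ-mono-≤ e (≤ᵇ⇒≤ _) 1≤2∣y∣ ⟩
    (ι 2 * ∣ y ∣) ^ℚ e          ≡⟨ ^ℚ-distrib-* (ι 2) ∣ y ∣ e ⟩
    ι 2 ^ℚ e * ∣ y ∣ ^ℚ e       ≡⟨ cong (ι 2 ^ℚ e *_) (sym (∣^ℚ∣ y e)) ⟩
    ι 2 ^ℚ e * ∣ y ^ℚ e ∣       ∎)
    where
    open ≤-Reasoning
    1≤2∣y∣ : 1ℚ ≤ ι 2 * ∣ y ∣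
    1≤2∣y∣ = *-monoˡ-≤-nonNeg (ι 2) ½≤∣y∣

  inv-pos : ∀ {y} → 0ℚ < y → 0ℚ < inv y
  inv-pos {y} 0<y with y ≟ 0ℚ
  ... | yes y≡0 = ⊥-elim (<⇒≢ 0<y (sym y≡0))
  ... | no  _   = positive⁻¹ _ {{1/pos⇒pos y {{positive 0<y}}}}

  Σ<-cong : ∀ m {f g} → (∀ j → j ℕ.< m → f j ≡ g j) → Σ< m f ≡ Σ< m g
  Σ<-cong zero    _   = refl
  Σ<-cong (suc m) f≡g = cong₂ _+_ (Σ<-cong m (λ j j<m → f≡g j (ℕP.m<n⇒m<1+n j<m))) (f≡g m ℕP.≤-refl)

  Σ<-mono-≤ : ∀ m {f g} → (∀ j → j ℕ.< m → f j ≤ g j) → Σ< m f ≤ Σ< m g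
  Σ<-mono-≤ zero    _   = ≤-refl
  Σ<-mono-≤ (suc m) f≤g = +-mono-≤ (Σ<-mono-≤ m (λ j j<m → f≤g j (ℕP.m<n⇒m<1+n j<m))) (f≤g m ℕP.≤-refl)

  Σ<-nonNeg : ∀ m {f} → (∀ j → j ℕ.< m → 0ℚ ≤ f j) → 0ℚ ≤ Σ< m f
  Σ<-nonNeg zero    _     = ≤-refl
  Σ<-nonNeg (suc m) 0≤f = +-nonNeg (Σ<-nonNeg m (λ j j<m → 0≤f j (ℕP.m<n⇒m<1+n j<m))) (0≤f m ℕP.≤-refl)

  Σ<-*ˡ : ∀ m c f → Σ< m (λ j → c * f j) ≡ c * Σ< m f
  Σ<-*ˡ zero    c f = sym (*-zeroʳ c)
  Σ<-*ˡ (suc m) c f = trans (cong (_+ c * f m) (Σ<-*ˡ m c f)) (sym (*-distribˡ-+ c (Σ< m f) (f m)))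

  Σ<-sub : ∀ m f g → Σ< m (λ j → f j - g j) ≡ Σ< m f - Σ< m g
  Σ<-sub zero    f g = refl
  Σ<-sub (suc m) f g = trans (cong (_+ (f m - g m)) (Σ<-sub m f g)) (regroup (Σ< m f) (Σ< m g) (f m) (g m))
    where
    regroup : ∀ a b c d → (a - b) + (c - d) ≡ (a + c) - (b + d)
    regroup = solve 4 (λ a b c d → (a :- b) :+ (c :- d) := (a :+ c) :- (b :+ d)) refl

  Σ<-const : ∀ m c → Σ< m (λ _ → c) ≡ ι m * c
  Σ<-const zero    c = sym (*-zeroˡ c)
  Σ<-const (suc m) c = begin
    Σ< m (λ _ → c) + c       ≡⟨ cong₂ _+_ (Σ<-const m c) (sym (*-identityˡ c)) ⟩
    ι m * c + 1ℚ * c         ≡⟨ sym (*-distribʳ-+ c (ι m) 1ℚ) ⟩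
    (ι m + 1ℚ) * c           ≡⟨ cong (_* c) (trans (+-comm (ι m) 1ℚ) (sym (ι-suc m))) ⟩
    ι (suc m) * c            ∎
    where open ≡-Reasoning

  ∣Σ<∣≤Σ<∣∣ : ∀ m f → ∣ Σ< m f ∣ ≤ Σ< m (λ j → ∣ f j ∣)
  ∣Σ<∣≤Σ<∣∣ zero    f = ≤-refl
  ∣Σ<∣≤Σ<∣∣ (suc m) f = ≤-trans (∣p+q∣≤∣p∣+∣q∣ (Σ< m f) (f m)) (+-monoˡ-≤ ∣ f m ∣ (∣Σ<∣≤Σ<∣∣ m f))

  Σ<-term≤ : ∀ m {f k} → (∀ j → j ℕ.< m → 0ℚ ≤ f j) → k ℕ.< m → f k ≤ Σ< m f
  Σ<-term≤ (suc m) {f} {k} 0≤f k<1+m with ℕP.m<1+n⇒m<n∨m≡n k<1+m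
  ... | inj₁ k<m  = ≤-trans (Σ<-term≤ m (λ j j<m → 0≤f j (ℕP.m<n⇒m<1+n j<m)) k<m) (p≤p+q (0≤f m ℕP.≤-refl))
  ... | inj₂ refl = ≤-trans (≤-reflexive (sym (+-identityˡ (f m))))
                            (+-monoˡ-≤ (f m) (Σ<-nonNeg m (λ j j<m → 0≤f j (ℕP.m<n⇒m<1+n j<m))))

  ∣Σ<f-fk∣≤Σ<g : ∀ m {f g k} → k ℕ.< m → (∀ j → j ℕ.< m → j ≢ k → ∣ f j ∣ ≤ g j) →
                 (∀ j → j ℕ.< m → 0ℚ ≤ g j) → ∣ Σ< m f - f k ∣ ≤ Σ< m g
  ∣Σ<f-fk∣≤Σ<g (suc m) {f} {g} {k} k<1+m ∣f∣≤g 0≤g with ℕP.m<1+n⇒m<n∨m≡n k<1+m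
  ... | inj₂ refl = begin
    ∣ Σ< m f + f m - f m ∣       ≡⟨ cong ∣_∣ (cancel (Σ< m f) (f m)) ⟩
    ∣ Σ< m f ∣                   ≤⟨ ∣Σ<∣≤Σ<∣∣ m f ⟩
    Σ< m (λ j → ∣ f j ∣)         ≤⟨ Σ<-mono-≤ m (λ j j<m → ∣f∣≤g j (ℕP.m<n⇒m<1+n j<m) (ℕP.<⇒≢ j<m)) ⟩
    Σ< m g                       ≤⟨ p≤p+q (0≤g m ℕP.≤-refl) ⟩
    Σ< m g + g m                 ∎
    where
    open ≤-Reasoning
    cancel : ∀ a b → a + b - b ≡ a
    cancel = solve 2 (λ a b → a :+ b :- b := a) refl
  ... | inj₁ k<m = begin
    ∣ Σ< m f + f m - f k ∣        ≡⟨ cong ∣_∣ (swap (Σ< m f) (f m) (f k)) ⟩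
    ∣ (Σ< m f - f k) + f m ∣      ≤⟨ ∣p+q∣≤∣p∣+∣q∣ (Σ< m f - f k) (f m) ⟩
    ∣ Σ< m f - f k ∣ + ∣ f m ∣    ≤⟨ +-mono-≤ (∣Σ<f-fk∣≤Σ<g m k<m (λ j j<m → ∣f∣≤g j (ℕP.m<n⇒m<1+n j<m))
                                                                 (λ j j<m → 0≤g j (ℕP.m<n⇒m<1+n j<m)))
                                               (∣f∣≤g m ℕP.≤-refl (ℕP.>⇒≢ k<m)) ⟩
    Σ< m g + g m                  ∎
    where
    open ≤-Reasoning
    swap : ∀ a b c → a + b - c ≡ (a - c) + b
    swap = solve 3 (λ a b c → a :+ b :- c := (a :- c) :+ b) refl

  ∣Σ<-column∣≤ : ∀ m m′ {F G : ℕ → ℕ → ℚ} {k} → k ℕ.< m′ →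
                 (∀ j → j ℕ.< m → ∀ k′ → k′ ℕ.< m′ → k′ ≢ k → ∣ F j k′ ∣ ≤ G j k′) →
                 (∀ j → j ℕ.< m → ∀ k′ → k′ ℕ.< m′ → 0ℚ ≤ G j k′) →
                 ∣ Σ< m (λ j → F j k) ∣ ≤ ∣ Σ< m (λ j → Σ< m′ (F j)) ∣ + Σ< m (λ j → Σ< m′ (G j))
  ∣Σ<-column∣≤ m m′ {F} {G} {k} k<m′ ∣F∣≤G 0≤G = begin
    ∣ Σ< m (λ j → F j k) ∣                          ≡⟨ cong ∣_∣ (y-[y-x]≡x S (Σ< m (λ j → F j k))) ⟨
    ∣ S - (S - Σ< m (λ j → F j k)) ∣                ≡⟨ cong (λ z → ∣ S - z ∣) (Σ<-sub m (λ j → Σ< m′ (F j)) (λ j → F j k)) ⟨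
    ∣ S - Σ< m E ∣                                  ≤⟨ ∣p-q∣≤∣p∣+∣q∣ S (Σ< m E) ⟩
    ∣ S ∣ + ∣ Σ< m E ∣                              ≤⟨ +-monoʳ-≤ ∣ S ∣ (∣Σ<∣≤Σ<∣∣ m E) ⟩
    ∣ S ∣ + Σ< m (λ j → ∣ E j ∣)                    ≤⟨ +-monoʳ-≤ ∣ S ∣ (Σ<-mono-≤ m ∣E∣≤) ⟩
    ∣ S ∣ + Σ< m (λ j → Σ< m′ (G j))                ∎
    where
    open ≤-Reasoning
    S = Σ< m (λ j → Σ< m′ (F j))
    E : ℕ → ℚ
    E j = Σ< m′ (F j) - F j k
    ∣E∣≤ : ∀ j → j ℕ.< m → ∣ E j ∣ ≤ Σ< m′ (G j)
    ∣E∣≤ j j<m = ∣Σ<f-fk∣≤Σ<g m′ k<m′ (∣F∣≤G j j<m) (0≤G j j<m)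
    y-[y-x]≡x : ∀ y x → y - (y - x) ≡ x
    y-[y-x]≡x = solve 2 (λ y x → y :- (y :- x) := x) refl

  -- Distance from the poles

  ≤-½⇒½≤∣∣ : ∀ {y} → y ≤ - half → half ≤ ∣ y ∣
  ≤-½⇒½≤∣∣ {y} y≤-½ = ≤-trans (subst (_≤ - y) (neg-involutive half) (neg-antimono-≤ y≤-½))
                                (≤-trans (p≤∣p∣ (- y)) (≤-reflexive (∣-p∣≡∣p∣ y)))

  ½≤⇒½≤∣∣ : ∀ {y} → half ≤ y → half ≤ ∣ y ∣
  ½≤⇒½≤∣∣ {y} ½≤y = ≤-trans ½≤y (p≤∣p∣ y)

  ∣x+½∣≤∣x∣ : ∀ {x} → x ≤ - half → ∣ x + half ∣ ≤ ∣ x ∣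
  ∣x+½∣≤∣x∣ {x} x≤-½ = -q≤p≤q⇒∣p∣≤q
    (≤-trans (∣p∣≤q⇒-q≤p ≤-refl) (p≤p+q (≤ᵇ⇒≤ _)))
    (≤-trans (+-monoˡ-≤ half x≤-½) (≤-trans (≤ᵇ⇒≤ _) (0≤∣p∣ x)))

  ∣x-½∣≤∣x∣ : ∀ {x} → half ≤ x → ∣ x - half ∣ ≤ ∣ x ∣
  ∣x-½∣≤∣x∣ {x} ½≤x = begin
    ∣ x - half ∣   ≡⟨ 0≤p⇒∣p∣≡p (≤-trans (≤ᵇ⇒≤ _) (+-monoˡ-≤ (- half) ½≤x)) ⟩
    x - half       ≤⟨ p-q≤p {q = half} (≤ᵇ⇒≤ _) ⟩
    x              ≤⟨ p≤∣p∣ x ⟩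
    ∣ x ∣          ∎
    where open ≤-Reasoning

  module PoleDistances {ε : ℚ} (∣ε∣≤½ : ∣ ε ∣ ≤ half) where

    ε-ι≤-½ : ∀ {d} → 0 ℕ.< d → ε - ι d ≤ - half
    ε-ι≤-½ {suc d} _ = begin
      ε - ι (suc d)                    ≤⟨ +-monoˡ-≤ (- ι (suc d)) (∣p∣≤q⇒p≤q ∣ε∣≤½) ⟩
      half - ι (suc d)                 ≡⟨ cong (λ z → half - z) (ι-suc d) ⟩
      half - (1ℚ + ι d)                ≤⟨ p≤p+q (ι-nonNeg d) ⟩
      half - (1ℚ + ι d) + ι d          ≡⟨ solve 1 (λ x → con half :- (con 1ℚ :+ x) :+ x := :- con half) refl (ι d) ⟩
      - half                           ∎
      where open ≤-Reasoning

    ½≤ε+ι : ∀ {d} → 0 ℕ.< d → half ≤ ε + ι d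
    ½≤ε+ι {suc d} _ = begin
      half                             ≡⟨ solve 1 (λ x → con half := :- con half :+ (con 1ℚ :+ x) :- x) refl (ι d) ⟩
      - half + (1ℚ + ι d) - ι d        ≤⟨ p-q≤p (ι-nonNeg d) ⟩
      - half + (1ℚ + ι d)              ≡⟨ cong (- half +_) (sym (ι-suc d)) ⟩
      - half + ι (suc d)               ≤⟨ +-monoˡ-≤ (ι (suc d)) (∣p∣≤q⇒-q≤p ∣ε∣≤½) ⟩
      ε + ι (suc d)                    ∎
      where open ≤-Reasoning

    shift-below : ∀ {j k} → j ℕ.≤ k → ε - ι k + ι j ≡ ε - ι (k ℕ.∸ j)
    shift-below {j} {k} j≤k = trans (cong (λ z → ε - z + ι j) (ι-∸ j≤k))
      (solve 3 (λ e d x → e :- (d :+ x) :+ x := e :- d) refl ε (ι (k ℕ.∸ j)) (ι j))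

    shift-above : ∀ {j k} → k ℕ.≤ j → ε - ι k + ι j ≡ ε + ι (j ℕ.∸ k)
    shift-above {j} {k} k≤j = trans (cong (ε - ι k +_) (ι-∸ k≤j))
      (solve 3 (λ e d x → e :- x :+ (d :+ x) := e :+ d) refl ε (ι (j ℕ.∸ k)) (ι k))

    below : ∀ {j k} → j ℕ.< k → ∣ ε - ι k + half + ι j ∣ ≤ ∣ ε - ι k + ι j ∣
    below {j} {k} j<k = subst (λ z → ∣ z ∣ ≤ ∣ ε - ι k + ι j ∣)
      (solve 3 (λ t x h → t :+ x :+ h := t :+ h :+ x) refl (ε - ι k) (ι j) half)
      (∣x+½∣≤∣x∣ (subst (_≤ - half) (sym (shift-below (ℕP.<⇒≤ j<k))) (ε-ι≤-½ (ℕP.m<n⇒0<n∸m j<k))))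

    above : ∀ {j k} → k ℕ.≤ j → ∣ ε - ι k + half + ι j ∣ ≤ ∣ ε - ι k + ι (suc j) ∣
    above {j} {k} k≤j = subst (λ z → ∣ z ∣ ≤ ∣ ε - ι k + ι (suc j) ∣)
      (trans (cong (λ z → ε - ι k + z - half) (ι-suc j))
             (solve 3 (λ t x h → t :+ (con 1ℚ :+ x) :- con half := t :+ con half :+ x) refl (ε - ι k) (ι j) half))
      (∣x-½∣≤∣x∣ (subst (half ≤_) (sym (shift-above (ℕP.m≤n⇒m≤1+n k≤j))) (½≤ε+ι (ℕP.m<n⇒0<n∸m (ℕ.s≤s k≤j)))))

    far : ∀ {k k′} → k′ ≢ k → half ≤ ∣ ε - ι k + ι k′ ∣
    far {k} {k′} k′≢k with ℕP.<-cmp k′ k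
    ... | tri< k′<k _ _ = ≤-½⇒½≤∣∣ (subst (_≤ - half) (sym (shift-below (ℕP.<⇒≤ k′<k))) (ε-ι≤-½ (ℕP.m<n⇒0<n∸m k′<k)))
    ... | tri≈ _ k′≡k _ = ⊥-elim (k′≢k k′≡k)
    ... | tri> _ _ k<k′ = ½≤⇒½≤∣∣ (subst (half ≤_) (sym (shift-above (ℕP.<⇒≤ k<k′))) (½≤ε+ι (ℕP.m<n⇒0<n∸m k<k′)))

  ∣Π<∣-mono-≤ : ∀ m {f g} → (∀ j → j ℕ.< m → ∣ f j ∣ ≤ ∣ g j ∣) → ∣ Π< m f ∣ ≤ ∣ Π< m g ∣
  ∣Π<∣-mono-≤ zero    _       = ≤-refl
  ∣Π<∣-mono-≤ (suc m) {f} {g} ∣f∣≤∣g∣ = begin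
    ∣ Π< m f * f m ∣          ≡⟨ ∣p*q∣≡∣p∣*∣q∣ (Π< m f) (f m) ⟩
    ∣ Π< m f ∣ * ∣ f m ∣      ≤⟨ *-mono-≤-nonNeg (0≤∣p∣ _) (0≤∣p∣ _)
                                   (∣Π<∣-mono-≤ m (λ j j<m → ∣f∣≤∣g∣ j (ℕP.m<n⇒m<1+n j<m))) (∣f∣≤∣g∣ m ℕP.≤-refl) ⟩
    ∣ Π< m g ∣ * ∣ g m ∣      ≡⟨ sym (∣p*q∣≡∣p∣*∣q∣ (Π< m g) (g m)) ⟩
    ∣ Π< m g * g m ∣          ∎
    where open ≤-Reasoning

  ∣Π<∣-interleave : ∀ {f g : ℕ → ℚ} {k n} → k ℕ.≤′ n →
    (∀ j → j ℕ.< k → ∣ f j ∣ ≤ ∣ g j ∣) → (∀ j → k ℕ.≤ j → ∣ f j ∣ ≤ ∣ g (suc j) ∣) →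
    ∣ g k ∣ * ∣ Π< n f ∣ ≤ ∣ Π< (suc n) g ∣
  ∣Π<∣-interleave {f} {g} {k} ℕ.≤′-refl below above = begin
    ∣ g k ∣ * ∣ Π< k f ∣      ≤⟨ *-monoˡ-≤-nonNeg ∣ g k ∣ {{∣-∣-nonNeg (g k)}} (∣Π<∣-mono-≤ k below) ⟩
    ∣ g k ∣ * ∣ Π< k g ∣      ≡⟨ *-comm (∣ g k ∣) (∣ Π< k g ∣) ⟩
    ∣ Π< k g ∣ * ∣ g k ∣      ≡⟨ sym (∣p*q∣≡∣p∣*∣q∣ (Π< k g) (g k)) ⟩
    ∣ Π< k g * g k ∣          ∎
    where open ≤-Reasoning
  ∣Π<∣-interleave {f} {g} {k} {suc n} (ℕ.≤′-step k≤′n) below above = begin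
    ∣ g k ∣ * ∣ Π< n f * f n ∣                   ≡⟨ cong (∣ g k ∣ *_) (∣p*q∣≡∣p∣*∣q∣ (Π< n f) (f n)) ⟩
    ∣ g k ∣ * (∣ Π< n f ∣ * ∣ f n ∣)             ≡⟨ sym (*-assoc (∣ g k ∣) (∣ Π< n f ∣) (∣ f n ∣)) ⟩
    ∣ g k ∣ * ∣ Π< n f ∣ * ∣ f n ∣               ≤⟨ *-mono-≤-nonNeg (*-nonNeg (0≤∣p∣ (g k)) (0≤∣p∣ _)) (0≤∣p∣ (f n))
                                                      (∣Π<∣-interleave k≤′n below above) (above n (ℕP.≤′⇒≤ k≤′n)) ⟩
    ∣ Π< (suc n) g ∣ * ∣ g (suc n) ∣             ≡⟨ sym (∣p*q∣≡∣p∣*∣q∣ (Π< (suc n) g) (g (suc n))) ⟩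
    ∣ Π< (suc n) g * g (suc n) ∣                 ∎
    where open ≤-Reasoning

  ε⁴R-bound : ℕ → ℚ
  ε⁴R-bound n = ι 2 ^ℚ (8 ℕ.* n) * ι (3 ℕ.* suc n)

  module NearPole {ε : ℚ} (∣ε∣≤½ : ∣ ε ∣ ≤ half) {k n : ℕ} (k≤n : k ℕ.≤ n) where
    open PoleDistances ∣ε∣≤½

    ∣ε∣*∣poch∣≤∣poch∣ : ∣ ε ∣ * ∣ poch (ε - ι k + half) n ∣ ≤ ∣ poch (ε - ι k) (suc n) ∣
    ∣ε∣*∣poch∣≤∣poch∣ = subst (λ z → ∣ z ∣ * ∣ poch (ε - ι k + half) n ∣ ≤ ∣ poch (ε - ι k) (suc n) ∣)
      (p-q+q≡p ε (ι k))
      (∣Π<∣-interleave (ℕP.≤⇒≤′ k≤n) (λ _ → below) (λ _ → above))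

    ∣2t+n∣≤ : ∣ ι 2 * (ε - ι k) + ι n ∣ ≤ ι (3 ℕ.* suc n)
    ∣2t+n∣≤ = begin
      ∣ ι 2 * (ε - ι k) + ι n ∣          ≤⟨ ∣p+q∣≤∣p∣+∣q∣ (ι 2 * (ε - ι k)) (ι n) ⟩
      ∣ ι 2 * (ε - ι k) ∣ + ∣ ι n ∣      ≡⟨ cong₂ _+_ (∣ι*p∣≡ι*∣p∣ 2 (ε - ι k)) (0≤p⇒∣p∣≡p (ι-nonNeg n)) ⟩
      ι 2 * ∣ ε - ι k ∣ + ι n            ≤⟨ +-monoˡ-≤ (ι n) (*-monoˡ-≤-nonNeg (ι 2) ∣t∣≤1+n) ⟩
      ι 2 * ι (suc n) + ι n              ≡⟨ cong (_+ ι n) (ι-* 2 (suc n)) ⟨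
      ι (2 ℕ.* suc n) + ι n              ≡⟨ ι-+ (2 ℕ.* suc n) n ⟨
      ι (2 ℕ.* suc n ℕ.+ n)              ≤⟨ ι-mono-≤ (ℕP.≤-trans (ℕP.n≤1+n _) (ℕP.≤-reflexive (sym (3[1+n] n)))) ⟩
      ι (3 ℕ.* suc n)                    ∎
      where
      open ≤-Reasoning
      3[1+n] : ∀ n → 3 ℕ.* suc n ≡ suc (2 ℕ.* suc n ℕ.+ n)
      3[1+n] = solve-∀
      ∣t∣≤1+n : ∣ ε - ι k ∣ ≤ ι (suc n)
      ∣t∣≤1+n = begin
        ∣ ε - ι k ∣              ≤⟨ ∣p-q∣≤∣p∣+∣q∣ ε (ι k) ⟩
        ∣ ε ∣ + ∣ ι k ∣          ≡⟨ cong (∣ ε ∣ +_) (0≤p⇒∣p∣≡p (ι-nonNeg k)) ⟩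
        ∣ ε ∣ + ι k              ≤⟨ +-mono-≤ (≤-trans ∣ε∣≤½ ½≤1) (ι-mono-≤ k≤n) ⟩
        1ℚ + ι n                 ≡⟨ ι-suc n ⟨
        ι (suc n)                ∎

    ∣ε⁴R∣≤ : ∣ ε ^ℚ 4 * R n (ε - ι k) ∣ ≤ ε⁴R-bound n
    ∣ε⁴R∣≤ = begin
      ∣ ε ^ℚ 4 * R n t ∣                              ≡⟨ cong ∣_∣ (regroup (ε ^ℚ 4) C L (P ^ℚ 4) (inv (Q ^ℚ 4))) ⟩
      ∣ C * L * (ε ^ℚ 4 * P ^ℚ 4 * inv (Q ^ℚ 4)) ∣    ≡⟨ ∣p*q∣≡∣p∣*∣q∣ (C * L) _ ⟩
      ∣ C * L ∣ * ∣ ε ^ℚ 4 * P ^ℚ 4 * inv (Q ^ℚ 4) ∣  ≤⟨ *-monoˡ-≤-nonNeg ∣ C * L ∣ {{∣-∣-nonNeg (C * L)}}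
                                                           (∣*inv∣≤1 ∣ε⁴P⁴∣≤∣Q⁴∣) ⟩
      ∣ C * L ∣ * 1ℚ                                  ≡⟨ *-identityʳ ∣ C * L ∣ ⟩
      ∣ C * L ∣                                       ≡⟨ ∣p*q∣≡∣p∣*∣q∣ C L ⟩
      ∣ C ∣ * ∣ L ∣                                   ≡⟨ cong (_* ∣ L ∣) (0≤p⇒∣p∣≡p 0≤C) ⟩
      C * ∣ L ∣                                       ≤⟨ *-monoˡ-≤-nonNeg C {{nonNegative 0≤C}} ∣2t+n∣≤ ⟩
      C * ι (3 ℕ.* suc n)                             ∎
      where
      open ≤-Reasoning
      t = ε - ι k
      C = ι 2 ^ℚ (8 ℕ.* n)
      L = ι 2 * t + ι n
      P = poch (t + half) n
      Q = poch t (suc n)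
      0≤C : 0ℚ ≤ C
      0≤C = ^ℚ-nonNeg (8 ℕ.* n) (ι-nonNeg 2)
      regroup : ∀ e c l p q → e * (c * l * p * q) ≡ c * l * (e * p * q)
      regroup = solve 5 (λ e c l p q → e :* (c :* l :* p :* q) := c :* l :* (e :* p :* q)) refl
      ∣ε⁴P⁴∣≤∣Q⁴∣ : ∣ ε ^ℚ 4 * P ^ℚ 4 ∣ ≤ ∣ Q ^ℚ 4 ∣
      ∣ε⁴P⁴∣≤∣Q⁴∣ = begin
        ∣ ε ^ℚ 4 * P ^ℚ 4 ∣     ≡⟨ cong ∣_∣ (sym (^ℚ-distrib-* ε P 4)) ⟩
        ∣ (ε * P) ^ℚ 4 ∣        ≡⟨ ∣^ℚ∣ (ε * P) 4 ⟩
        ∣ ε * P ∣ ^ℚ 4          ≡⟨ cong (_^ℚ 4) (∣p*q∣≡∣p∣*∣q∣ ε P) ⟩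
        (∣ ε ∣ * ∣ P ∣) ^ℚ 4    ≤⟨ ^ℚ-mono-≤ 4 (*-nonNeg (0≤∣p∣ ε) (0≤∣p∣ P)) ∣ε∣*∣poch∣≤∣poch∣ ⟩
        ∣ Q ∣ ^ℚ 4              ≡⟨ sym (∣^ℚ∣ Q 4) ⟩
        ∣ Q ^ℚ 4 ∣              ∎

  -- Coefficients of a cubic

  -- Indexed so that the terms r_{n,i,k} ε^{4-i} form cubic (λ j → r (suc j) k) ε.
  cubic : (ℕ → ℚ) → ℚ → ℚ
  cubic c x = Σ< 4 (λ j → c j * x ^ℚ (3 ℕ.∸ j))

  Stencil : Set
  Stencil = ℚ × ℚ × ℚ × ℚ

  at-nodes : Stencil → (ℚ → ℚ) → ℚ → ℚ
  at-nodes (w₁ , w₂ , w₃ , w₄) p a = w₁ * p a + w₂ * p (- a) + w₃ * p (a + a) + w₄ * p (- (a + a))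

  mass : Stencil → ℚ
  mass (w₁ , w₂ , w₃ , w₄) = ∣ w₁ ∣ + ∣ w₂ ∣ + ∣ w₃ ∣ + ∣ w₄ ∣

  -- stencil j solves the Vandermonde system at a, -a, 2a, -2a for the coefficient of x^(3-j).
  stencil : ℕ → Stencil
  stencil 0 = - (ℤ.+ 1 / 6) , ℤ.+ 1 / 6 , ℤ.+ 1 / 12 , - (ℤ.+ 1 / 12)
  stencil 1 = - (ℤ.+ 1 / 6) , - (ℤ.+ 1 / 6) , ℤ.+ 1 / 6 , ℤ.+ 1 / 6
  stencil 2 = ℤ.+ 2 / 3 , - (ℤ.+ 2 / 3) , - (ℤ.+ 1 / 12) , ℤ.+ 1 / 12
  stencil _ = ℤ.+ 2 / 3 , ℤ.+ 2 / 3 , - (ℤ.+ 1 / 6) , - (ℤ.+ 1 / 6)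

  module _ {v : ℕ} where
    cubicᵉ : Polynomial v → Polynomial v → Polynomial v → Polynomial v → Polynomial v → Polynomial v
    cubicᵉ c₀ c₁ c₂ c₃ x = con 0ℚ :+ c₀ :* x :^ 3 :+ c₁ :* x :^ 2 :+ c₂ :* x :^ 1 :+ c₃ :* x :^ 0

    at-nodesᵉ : Stencil → (Polynomial v → Polynomial v) → Polynomial v → Polynomial v
    at-nodesᵉ (w₁ , w₂ , w₃ , w₄) p a =
      con w₁ :* p a :+ con w₂ :* p (:- a) :+ con w₃ :* p (a :+ a) :+ con w₄ :* p (:- (a :+ a))

  stencil-exact : ∀ c a j → j ℕ.< 4 → c j * a ^ℚ (3 ℕ.∸ j) ≡ at-nodes (stencil j) (cubic c) a
  stencil-exact c a 0 _ = solve 5 (λ c₀ c₁ c₂ c₃ x →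
    c₀ :* x :^ 3 := at-nodesᵉ (stencil 0) (cubicᵉ c₀ c₁ c₂ c₃) x) refl (c 0) (c 1) (c 2) (c 3) a
  stencil-exact c a 1 _ = solve 5 (λ c₀ c₁ c₂ c₃ x →
    c₁ :* x :^ 2 := at-nodesᵉ (stencil 1) (cubicᵉ c₀ c₁ c₂ c₃) x) refl (c 0) (c 1) (c 2) (c 3) a
  stencil-exact c a 2 _ = solve 5 (λ c₀ c₁ c₂ c₃ x →
    c₂ :* x :^ 1 := at-nodesᵉ (stencil 2) (cubicᵉ c₀ c₁ c₂ c₃) x) refl (c 0) (c 1) (c 2) (c 3) a
  stencil-exact c a 3 _ = solve 5 (λ c₀ c₁ c₂ c₃ x →
    c₃ :* x :^ 0 := at-nodesᵉ (stencil 3) (cubicᵉ c₀ c₁ c₂ c₃) x) refl (c 0) (c 1) (c 2) (c 3) a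
  stencil-exact c a (suc (suc (suc (suc _)))) (ℕ.s≤s (ℕ.s≤s (ℕ.s≤s (ℕ.s≤s ()))))

  mass-stencil≤2 : ∀ j → mass (stencil j) ≤ ι 2
  mass-stencil≤2 0                   = ≤ᵇ⇒≤ _
  mass-stencil≤2 1                   = ≤ᵇ⇒≤ _
  mass-stencil≤2 2                   = ≤ᵇ⇒≤ _
  mass-stencil≤2 (suc (suc (suc _))) = ≤ᵇ⇒≤ _

  ∣at-nodes∣≤ : ∀ w p {a B} → ∣ p a ∣ ≤ B → ∣ p (- a) ∣ ≤ B → ∣ p (a + a) ∣ ≤ B → ∣ p (- (a + a)) ∣ ≤ B →
                ∣ at-nodes w p a ∣ ≤ mass w * B
  ∣at-nodes∣≤ (w₁ , w₂ , w₃ , w₄) p {a} {B} b₁ b₂ b₃ b₄ = begin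
    ∣ x₁ + x₂ + x₃ + x₄ ∣
      ≤⟨ ∣p+q∣≤∣p∣+∣q∣ (x₁ + x₂ + x₃) x₄ ⟩
    ∣ x₁ + x₂ + x₃ ∣ + ∣ x₄ ∣
      ≤⟨ +-monoˡ-≤ ∣ x₄ ∣ (∣p+q∣≤∣p∣+∣q∣ (x₁ + x₂) x₃) ⟩
    ∣ x₁ + x₂ ∣ + ∣ x₃ ∣ + ∣ x₄ ∣
      ≤⟨ +-monoˡ-≤ ∣ x₄ ∣ (+-monoˡ-≤ ∣ x₃ ∣ (∣p+q∣≤∣p∣+∣q∣ x₁ x₂)) ⟩
    ∣ x₁ ∣ + ∣ x₂ ∣ + ∣ x₃ ∣ + ∣ x₄ ∣
      ≤⟨ +-mono-≤ (+-mono-≤ (+-mono-≤ (term w₁ b₁) (term w₂ b₂)) (term w₃ b₃)) (term w₄ b₄) ⟩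
    ∣ w₁ ∣ * B + ∣ w₂ ∣ * B + ∣ w₃ ∣ * B + ∣ w₄ ∣ * B
      ≡⟨ collect (∣ w₁ ∣) (∣ w₂ ∣) (∣ w₃ ∣) (∣ w₄ ∣) B ⟩
    (∣ w₁ ∣ + ∣ w₂ ∣ + ∣ w₃ ∣ + ∣ w₄ ∣) * B
      ∎
    where
    open ≤-Reasoning
    x₁ = w₁ * p a
    x₂ = w₂ * p (- a)
    x₃ = w₃ * p (a + a)
    x₄ = w₄ * p (- (a + a))
    term : ∀ w {x} → ∣ x ∣ ≤ B → ∣ w * x ∣ ≤ ∣ w ∣ * B
    term w {x} ∣x∣≤B = ≤-trans (≤-reflexive (∣p*q∣≡∣p∣*∣q∣ w x)) (*-monoˡ-≤-nonNeg ∣ w ∣ {{∣-∣-nonNeg w}} ∣x∣≤B)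
    collect : ∀ x y z u b → x * b + y * b + z * b + u * b ≡ (x + y + z + u) * b
    collect = solve 5 (λ x y z u b → x :* b :+ y :* b :+ z :* b :+ u :* b := (x :+ y :+ z :+ u) :* b) refl

  cubic-coefficient-bound : ∀ c {a B} → 0ℚ < a →
    (∀ x → x ≢ 0ℚ → ∣ x ∣ ≤ a + a → ∣ cubic c x ∣ ≤ B) →
    ∀ j → j ℕ.< 4 → ∣ c j ∣ * a ^ℚ (3 ℕ.∸ j) ≤ ι 2 * B
  cubic-coefficient-bound c {a} {B} 0<a bounded j j<4 = begin
    ∣ c j ∣ * a ^ℚ (3 ℕ.∸ j)                  ≡⟨ cong (∣ c j ∣ *_) (sym (0≤p⇒∣p∣≡p (^ℚ-nonNeg (3 ℕ.∸ j) (<⇒≤ 0<a)))) ⟩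
    ∣ c j ∣ * ∣ a ^ℚ (3 ℕ.∸ j) ∣              ≡⟨ sym (∣p*q∣≡∣p∣*∣q∣ (c j) (a ^ℚ (3 ℕ.∸ j))) ⟩
    ∣ c j * a ^ℚ (3 ℕ.∸ j) ∣                  ≡⟨ cong ∣_∣ (stencil-exact c a j j<4) ⟩
    ∣ at-nodes (stencil j) (cubic c) a ∣      ≤⟨ ∣at-nodes∣≤ (stencil j) (cubic c) {a}
                                                   (at 0<a a≤2a) (at- 0<a a≤2a) (at 0<2a ≤-refl) (at- 0<2a ≤-refl) ⟩
    mass (stencil j) * B                      ≤⟨ *-monoʳ-≤-nonNeg B {{nonNegative 0≤B}} (mass-stencil≤2 j) ⟩
    ι 2 * B                                   ∎
    where
    open ≤-Reasoning
    a≤2a : a ≤ a + a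
    a≤2a = p≤p+q (<⇒≤ 0<a)
    0<2a : 0ℚ < a + a
    0<2a = <-≤-trans 0<a a≤2a
    ∣x∣≤2a : ∀ {x} → 0ℚ < x → x ≤ a + a → ∣ x ∣ ≤ a + a
    ∣x∣≤2a 0<x = ≤-trans (≤-reflexive (0≤p⇒∣p∣≡p (<⇒≤ 0<x)))
    at : ∀ {x} → 0ℚ < x → x ≤ a + a → ∣ cubic c x ∣ ≤ B
    at {x} 0<x x≤2a = bounded x (≢-sym (<⇒≢ 0<x)) (∣x∣≤2a 0<x x≤2a)
    at- : ∀ {x} → 0ℚ < x → x ≤ a + a → ∣ cubic c (- x) ∣ ≤ B
    at- {x} 0<x x≤2a = bounded (- x)
      (λ -x≡0 → <⇒≢ 0<x (sym (trans (sym (neg-involutive x)) (cong -_ -x≡0))))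
      (subst (_≤ a + a) (sym (∣-p∣≡∣p∣ x)) (∣x∣≤2a 0<x x≤2a))
    0≤B : 0ℚ ≤ B
    0≤B = ≤-trans (0≤∣p∣ (cubic c a)) (at 0<a a≤2a)

  -- Size of the partial-fraction coefficients

  norm₁ : (ℕ → ℕ → ℚ) → ℕ → ℚ
  norm₁ r n = Σ[ 1 to 4 ] (λ i → Σ[ 0 to n ] (λ k → ∣ r i k ∣))

  norm₁-nonNeg : ∀ r n → 0ℚ ≤ norm₁ r n
  norm₁-nonNeg r n = Σ<-nonNeg 4 (λ j _ → Σ<-nonNeg (suc n) (λ k _ → 0≤∣p∣ (r (suc j) k)))

  norm₁-scale : ∀ c r n → Σ< 4 (λ j → Σ< (suc n) (λ k → c * ∣ r (suc j) k ∣)) ≡ c * norm₁ r n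
  norm₁-scale c r n = trans (Σ<-cong 4 (λ j _ → Σ<-*ˡ (suc n) c (λ k → ∣ r (suc j) k ∣)))
                            (Σ<-*ˡ 4 c (λ j → Σ< (suc n) (λ k → ∣ r (suc j) k ∣)))

  module Coefficients (n : ℕ) (r : ℕ → ℕ → ℚ) (pf : IsPartialFractionOfR n r) {k : ℕ} (k≤n : k ℕ.≤ n) where

    term : ℚ → ℕ → ℕ → ℚ
    term ε i k′ = r i k′ * (ε ^ℚ 4 * inv ((ε - ι k + ι k′) ^ℚ i))

    ε⁴R-expansion : ∀ {ε} → ε ≢ 0ℚ → ∣ ε ∣ ≤ half →
      ε ^ℚ 4 * R n (ε - ι k) ≡ Σ< 4 (λ j → Σ< (suc n) (term ε (suc j)))
    ε⁴R-expansion {ε} ε≢0 ∣ε∣≤½ = begin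
      ε ^ℚ 4 * R n (ε - ι k)                   ≡⟨ cong (ε ^ℚ 4 *_) (pf (ε - ι k) no-pole) ⟩
      ε ^ℚ 4 * Σ< 4 (λ j → Σ< (suc n) (F j))   ≡⟨ sym (Σ<-*ˡ 4 (ε ^ℚ 4) (λ j → Σ< (suc n) (F j))) ⟩
      Σ< 4 (λ j → ε ^ℚ 4 * Σ< (suc n) (F j))   ≡⟨ Σ<-cong 4 (λ j _ → trans (sym (Σ<-*ˡ (suc n) (ε ^ℚ 4) (F j)))
                                                    (Σ<-cong (suc n) (λ k′ _ → *-exchangeˡ (ε ^ℚ 4) (r (suc j) k′) _))) ⟩
      Σ< 4 (λ j → Σ< (suc n) (term ε (suc j))) ∎
      where
      open ≡-Reasoning
      F : ℕ → ℕ → ℚ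
      F j k′ = r (suc j) k′ * inv ((ε - ι k + ι k′) ^ℚ suc j)
      no-pole : ∀ k′ → k′ ℕ.≤ n → ε - ι k + ι k′ ≢ 0ℚ
      no-pole k′ _ with k′ ℕ.≟ k
      ... | yes refl = subst (_≢ 0ℚ) (sym (p-q+q≡p ε (ι k))) ε≢0
      ... | no k′≢k  = λ y≡0 → ½≰0 (≤-trans (PoleDistances.far ∣ε∣≤½ k′≢k) (≤-reflexive (cong ∣_∣ y≡0)))
        where
        ½≰0 : ¬ (half ≤ 0ℚ)
        ½≰0 = ≤⇒≤ᵇ

    term-diagonal : ∀ {ε} → ε ≢ 0ℚ → ∀ j → j ℕ.< 4 → term ε (suc j) k ≡ r (suc j) k * ε ^ℚ (3 ℕ.∸ j)
    term-diagonal {ε} ε≢0 j j<4 = cong (r (suc j) k *_) (begin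
      ε ^ℚ 4 * inv ((ε - ι k + ι k) ^ℚ suc j)   ≡⟨ cong (λ y → ε ^ℚ 4 * inv (y ^ℚ suc j)) (p-q+q≡p ε (ι k)) ⟩
      ε ^ℚ 4 * inv (ε ^ℚ suc j)                 ≡⟨ ^ℚ-*-inv ε≢0 j<4 ⟩
      ε ^ℚ (3 ℕ.∸ j)                            ∎)
      where open ≡-Reasoning

    term-off-diagonal : ∀ {ε} → ∣ ε ∣ ≤ half → ∀ j → j ℕ.< 4 → ∀ k′ → k′ ≢ k →
      ∣ term ε (suc j) k′ ∣ ≤ ∣ ε ∣ ^ℚ 4 * ι 16 * ∣ r (suc j) k′ ∣
    term-off-diagonal {ε} ∣ε∣≤½ j j<4 k′ k′≢k = begin
      ∣ r (suc j) k′ * (ε ^ℚ 4 * inv y) ∣          ≡⟨ ∣p*q∣≡∣p∣*∣q∣ (r (suc j) k′) _ ⟩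
      ∣ r (suc j) k′ ∣ * ∣ ε ^ℚ 4 * inv y ∣        ≡⟨ cong (∣ r (suc j) k′ ∣ *_) (∣p*q∣≡∣p∣*∣q∣ (ε ^ℚ 4) (inv y)) ⟩
      ∣ r (suc j) k′ ∣ * (∣ ε ^ℚ 4 ∣ * ∣ inv y ∣)  ≤⟨ *-monoˡ-≤-nonNeg ∣ r (suc j) k′ ∣ {{∣-∣-nonNeg (r (suc j) k′)}}
                                                     (*-monoˡ-≤-nonNeg ∣ ε ^ℚ 4 ∣ {{∣-∣-nonNeg (ε ^ℚ 4)}} ∣inv-y∣≤16) ⟩
      ∣ r (suc j) k′ ∣ * (∣ ε ^ℚ 4 ∣ * ι 16)       ≡⟨ *-comm (∣ r (suc j) k′ ∣) _ ⟩
      ∣ ε ^ℚ 4 ∣ * ι 16 * ∣ r (suc j) k′ ∣         ≡⟨ cong (λ z → z * ι 16 * ∣ r (suc j) k′ ∣) (∣^ℚ∣ ε 4) ⟩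
      ∣ ε ∣ ^ℚ 4 * ι 16 * ∣ r (suc j) k′ ∣         ∎
      where
      open ≤-Reasoning
      y = (ε - ι k + ι k′) ^ℚ suc j
      ∣inv-y∣≤16 : ∣ inv y ∣ ≤ ι 16
      ∣inv-y∣≤16 = begin
        ∣ inv y ∣           ≤⟨ ∣inv[y^e]∣≤2^e (suc j) (PoleDistances.far ∣ε∣≤½ k′≢k) ⟩
        ι 2 ^ℚ suc j        ≡⟨ sym (ι-^ 2 (suc j)) ⟩
        ι (2 ℕ.^ suc j)     ≤⟨ ι-mono-≤ (ℕP.^-monoʳ-≤ 2 j<4) ⟩
        ι 16                ∎

    ∣cubic∣≤ : ∀ {ε} → ε ≢ 0ℚ → ∣ ε ∣ ≤ half →
      ∣ cubic (λ j → r (suc j) k) ε ∣ ≤ ε⁴R-bound n + ∣ ε ∣ ^ℚ 4 * ι 16 * norm₁ r n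
    ∣cubic∣≤ {ε} ε≢0 ∣ε∣≤½ = begin
      ∣ cubic (λ j → r (suc j) k) ε ∣
        ≡⟨ cong ∣_∣ (Σ<-cong 4 (λ j j<4 → sym (term-diagonal ε≢0 j j<4))) ⟩
      ∣ Σ< 4 (λ j → term ε (suc j) k) ∣
        ≤⟨ ∣Σ<-column∣≤ 4 (suc n) (ℕ.s≤s k≤n) (λ j j<4 k′ _ → term-off-diagonal ∣ε∣≤½ j j<4 k′)
                                              (λ j _ k′ _ → *-nonNeg 0≤D (0≤∣p∣ (r (suc j) k′))) ⟩
      ∣ Σ< 4 (λ j → Σ< (suc n) (term ε (suc j))) ∣ + Σ< 4 (λ j → Σ< (suc n) (λ k′ → D * ∣ r (suc j) k′ ∣))
        ≡⟨ cong₂ _+_ (cong ∣_∣ (sym (ε⁴R-expansion ε≢0 ∣ε∣≤½))) (norm₁-scale D r n) ⟩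
      ∣ ε ^ℚ 4 * R n (ε - ι k) ∣ + D * norm₁ r n
        ≤⟨ +-monoˡ-≤ (D * norm₁ r n) (NearPole.∣ε⁴R∣≤ ∣ε∣≤½ k≤n) ⟩
      ε⁴R-bound n + D * norm₁ r n
        ∎
      where
      open ≤-Reasoning
      D = ∣ ε ∣ ^ℚ 4 * ι 16
      0≤D : 0ℚ ≤ D
      0≤D = *-nonNeg (^ℚ-nonNeg 4 (0≤∣p∣ ε)) (ι-nonNeg 16)

    coefficient-bound : ∀ {a} → 0ℚ < a → a + a ≤ half → ∀ j → j ℕ.< 4 →
      ∣ r (suc j) k ∣ * a ^ℚ (3 ℕ.∸ j) ≤ ι 2 * (ε⁴R-bound n + (a + a) ^ℚ 4 * ι 16 * norm₁ r n)
    coefficient-bound {a} 0<a 2a≤½ = cubic-coefficient-bound (λ j → r (suc j) k) 0<a λ x x≢0 ∣x∣≤2a →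
      ≤-trans (∣cubic∣≤ x≢0 (≤-trans ∣x∣≤2a 2a≤½))
              (+-monoʳ-≤ (ε⁴R-bound n) (*-monoʳ-≤-nonNeg (norm₁ r n) {{nonNegative (norm₁-nonNeg r n)}}
                (*-monoʳ-≤-nonNeg (ι 16) {{nonNegative (ι-nonNeg 16)}} (^ℚ-mono-≤ 4 (0≤∣p∣ x) ∣x∣≤2a))))

  a³norm₁-self-bound : ∀ n r → IsPartialFractionOfR n r → ∀ {a} → 0ℚ < a → a + a ≤ half →
    a ^ℚ 3 * norm₁ r n ≤ ι 4 * (ι (suc n) * (ι 2 * (ε⁴R-bound n + (a + a) ^ℚ 4 * ι 16 * norm₁ r n)))
  a³norm₁-self-bound n r pf {a} 0<a 2a≤½ = begin
    a ^ℚ 3 * norm₁ r n                                    ≡⟨ sym (Σ<-*ˡ 4 (a ^ℚ 3) (λ j → Σ< (suc n) (∣r∣ j))) ⟩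
    Σ< 4 (λ j → a ^ℚ 3 * Σ< (suc n) (∣r∣ j))              ≡⟨ Σ<-cong 4 (λ j _ → sym (Σ<-*ˡ (suc n) (a ^ℚ 3) (∣r∣ j))) ⟩
    Σ< 4 (λ j → Σ< (suc n) (λ k → a ^ℚ 3 * ∣r∣ j k))      ≤⟨ Σ<-mono-≤ 4 (λ j j<4 → Σ<-mono-≤ (suc n) (λ k k≤n →
                                                               ≤-trans (a³∣r∣≤∣r∣a^[3-j] j k)
                                                                       (Coefficients.coefficient-bound n r pf (ℕP.≤-pred k≤n) 0<a 2a≤½ j j<4))) ⟩
    Σ< 4 (λ j → Σ< (suc n) (λ k → Z))                     ≡⟨ trans (Σ<-cong 4 (λ j _ → Σ<-const (suc n) Z)) (Σ<-const 4 (ι (suc n) * Z)) ⟩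
    ι 4 * (ι (suc n) * Z)                                 ∎
    where
    open ≤-Reasoning
    Z = ι 2 * (ε⁴R-bound n + (a + a) ^ℚ 4 * ι 16 * norm₁ r n)
    ∣r∣ : ℕ → ℕ → ℚ
    ∣r∣ j k = ∣ r (suc j) k ∣
    0≤a = <⇒≤ 0<a
    a≤1 : a ≤ 1ℚ
    a≤1 = ≤-trans (p≤p+q 0≤a) (≤-trans 2a≤½ ½≤1)
    a³∣r∣≤∣r∣a^[3-j] : ∀ j k → a ^ℚ 3 * ∣r∣ j k ≤ ∣r∣ j k * a ^ℚ (3 ℕ.∸ j)
    a³∣r∣≤∣r∣a^[3-j] j k = ≤-trans (*-monoʳ-≤-nonNeg (∣r∣ j k) {{∣-∣-nonNeg (r (suc j) k)}}
                                      (^ℚ-antimonoʳ 0≤a a≤1 (ℕP.m∸n≤m 3 j)))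
                                    (≤-reflexive (*-comm (a ^ℚ (3 ℕ.∸ j)) (∣r∣ j k)))

  p≤q+½p⇒p≤2q : ∀ {p q} → p ≤ q + half * p → p ≤ ι 2 * q
  p≤q+½p⇒p≤2q {p} {q} p≤q+½p = begin
    p                        ≡⟨ solve 1 (λ p → p := con (ι 2) :* (p :- con half :* p)) refl p ⟩
    ι 2 * (p - half * p)     ≤⟨ *-monoˡ-≤-nonNeg (ι 2) {{nonNegative (ι-nonNeg 2)}} p-½p≤q ⟩
    ι 2 * q                  ∎
    where
    open ≤-Reasoning
    p-½p≤q : p - half * p ≤ q
    p-½p≤q = ≤-trans (+-monoˡ-≤ (- (half * p)) p≤q+½p)
                     (≤-reflexive (solve 2 (λ q p → q :+ p :- p := q) refl q (half * p)))

  -- 4096 (n + 1) a = 1 makes the error term in a³norm₁-self-bound exactly half of a³ norm₁.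
  a³norm₁≤ : ∀ n r → IsPartialFractionOfR n r → ∀ {a} → 0ℚ < a → a + a ≤ half →
    ι 4096 * ι (suc n) * a ≡ 1ℚ → a ^ℚ 3 * norm₁ r n ≤ ι 16 * ι (suc n) * ε⁴R-bound n
  a³norm₁≤ n r pf {a} 0<a 2a≤½ 4096sa≡1 = begin
    a ^ℚ 3 * T             ≤⟨ p≤q+½p⇒p≤2q {q = ι 8 * s * B}
                                (≤-trans (a³norm₁-self-bound n r pf 0<a 2a≤½) (≤-reflexive rearranged)) ⟩
    ι 2 * (ι 8 * s * B)    ≡⟨ solve 2 (λ s B → con (ι 2) :* (con (ι 8) :* s :* B) := con (ι 16) :* s :* B) refl s B ⟩
    ι 16 * s * B           ∎
    where
    open ≤-Reasoning
    T = norm₁ r n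
    B = ε⁴R-bound n
    s = ι (suc n)
    rearranged : ι 4 * (s * (ι 2 * (B + (a + a) ^ℚ 4 * ι 16 * T))) ≡ ι 8 * s * B + half * (a ^ℚ 3 * T)
    rearranged = begin-equality
      ι 4 * (s * (ι 2 * (B + (a + a) ^ℚ 4 * ι 16 * T)))     ≡⟨ solve 4 (λ s B a T →
          con (ι 4) :* (s :* (con (ι 2) :* (B :+ (a :+ a) :^ 4 :* con (ι 16) :* T)))
          := con (ι 8) :* s :* B :+ (con (ι 4096) :* s :* a) :* (con half :* (a :^ 3 :* T))) refl s B a T ⟩
      ι 8 * s * B + ι 4096 * s * a * (half * (a ^ℚ 3 * T))  ≡⟨ cong (λ z → ι 8 * s * B + z * (half * (a ^ℚ 3 * T))) 4096sa≡1 ⟩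
      ι 8 * s * B + 1ℚ * (half * (a ^ℚ 3 * T))              ≡⟨ cong (ι 8 * s * B +_) (*-identityˡ (half * (a ^ℚ 3 * T))) ⟩
      ι 8 * s * B + half * (a ^ℚ 3 * T)                     ∎

  norm₁-bound : ∀ n r → IsPartialFractionOfR n r →
    norm₁ r n ≤ ι (4096 ℕ.* suc n) ^ℚ 3 * (ι 16 * ι (suc n) * ε⁴R-bound n)
  norm₁-bound n r pf = begin
    T                          ≡⟨ *-identityˡ T ⟨
    1ℚ ^ℚ 3 * T                ≡⟨ cong (λ z → z ^ℚ 3 * T) aM≡1 ⟨
    (a * M) ^ℚ 3 * T           ≡⟨ solve 3 (λ a M T → (a :* M) :^ 3 :* T := M :^ 3 :* (a :^ 3 :* T)) refl a M T ⟩
    M ^ℚ 3 * (a ^ℚ 3 * T)      ≤⟨ *-monoˡ-≤-nonNeg (M ^ℚ 3) {{nonNegative (^ℚ-nonNeg 3 (<⇒≤ 0<M))}}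
                                    (a³norm₁≤ n r pf (inv-pos 0<M) 2a≤½ 4096sa≡1) ⟩
    M ^ℚ 3 * (ι 16 * ι (suc n) * ε⁴R-bound n) ∎
    where
    open ≤-Reasoning
    T = norm₁ r n
    M = ι (4096 ℕ.* suc n)
    a = inv M
    0<M : 0ℚ < M
    0<M = <-≤-trans (positive⁻¹ 1ℚ) (ι-mono-≤ {1} {4096 ℕ.* suc n} (ℕ.s≤s ℕ.z≤n))
    aM≡1 : a * M ≡ 1ℚ
    aM≡1 = inv-inverseˡ (≢-sym (<⇒≢ 0<M))
    4096sa≡1 : ι 4096 * ι (suc n) * a ≡ 1ℚ
    4096sa≡1 = trans (cong (_* a) (sym (ι-* 4096 (suc n)))) (trans (*-comm M a) aM≡1)
    ¼ = ℤ.+ 1 / 4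
    a≤¼ : a ≤ ¼
    a≤¼ = ≤-trans (p≤∣p∣ a) (∣inv∣≤ {M} {¼} (≤ᵇ⇒≤ _) (≤-trans (≤ᵇ⇒≤ {q = ¼ * ι 4096} _)
            (*-monoˡ-≤-nonNeg ¼ (≤-trans (ι-mono-≤ {4096} {4096 ℕ.* suc n} (ℕP.m≤m*n 4096 (suc n))) (p≤∣p∣ M)))))
    2a≤½ : a + a ≤ half
    2a≤½ = ≤-trans (+-mono-≤ a≤¼ a≤¼) (≤ᵇ⇒≤ _)

  -- The quantities ρ

  ∣ρ₀-term∣≤ : ∀ i → i ℕ.≤ 4 → ∀ x ℓ →
    ∣ ι (i ℕ.* (i ℕ.+ 1)) * x * inv ((ι (suc ℓ) - half) ^ℚ (i ℕ.+ 2)) ∣ ≤ ι 1280 * ∣ x ∣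
  ∣ρ₀-term∣≤ i i≤4 x ℓ = begin
    ∣ ι c * x * inv y ∣                  ≡⟨ ∣p*q∣≡∣p∣*∣q∣ (ι c * x) (inv y) ⟩
    ∣ ι c * x ∣ * ∣ inv y ∣              ≡⟨ cong (_* ∣ inv y ∣) (∣ι*p∣≡ι*∣p∣ c x) ⟩
    ι c * ∣ x ∣ * ∣ inv y ∣              ≤⟨ *-monoˡ-≤-nonNeg (ι c * ∣ x ∣) {{nonNegative (*-nonNeg (ι-nonNeg c) (0≤∣p∣ x))}}
                                             (∣inv[y^e]∣≤2^e (i ℕ.+ 2) ½≤∣ℓ-½∣) ⟩
    ι c * ∣ x ∣ * ι 2 ^ℚ (i ℕ.+ 2)       ≡⟨ *-exchangeʳ (ι c) ∣ x ∣ (ι 2 ^ℚ (i ℕ.+ 2)) ⟩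
    ι c * ι 2 ^ℚ (i ℕ.+ 2) * ∣ x ∣       ≡⟨ cong (λ z → ι c * z * ∣ x ∣) (ι-^ 2 (i ℕ.+ 2)) ⟨
    ι c * ι (2 ℕ.^ (i ℕ.+ 2)) * ∣ x ∣    ≡⟨ cong (_* ∣ x ∣) (ι-* c (2 ℕ.^ (i ℕ.+ 2))) ⟨
    ι (c ℕ.* 2 ℕ.^ (i ℕ.+ 2)) * ∣ x ∣    ≤⟨ *-monoʳ-≤-nonNeg ∣ x ∣ {{∣-∣-nonNeg x}} (ι-mono-≤ c2^[i+2]≤1280) ⟩
    ι 1280 * ∣ x ∣                       ∎
    where
    open ≤-Reasoning
    c = i ℕ.* (i ℕ.+ 1)
    y = (ι (suc ℓ) - half) ^ℚ (i ℕ.+ 2)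
    c2^[i+2]≤1280 : c ℕ.* 2 ℕ.^ (i ℕ.+ 2) ℕ.≤ 4 ℕ.* 5 ℕ.* 2 ℕ.^ 6
    c2^[i+2]≤1280 = ℕP.*-mono-≤ (ℕP.*-mono-≤ i≤4 (ℕP.+-monoˡ-≤ 1 i≤4)) (ℕP.^-monoʳ-≤ 2 (ℕP.+-monoˡ-≤ 2 i≤4))
    ½≤∣ℓ-½∣ : half ≤ ∣ ι (suc ℓ) - half ∣
    ½≤∣ℓ-½∣ = ½≤⇒½≤∣∣ (≤-trans (p≤p+q (ι-nonNeg ℓ)) (≤-reflexive (begin-equality
      half + ι ℓ         ≡⟨ solve 1 (λ x → con half :+ x := con 1ℚ :+ x :- con half) refl (ι ℓ) ⟩
      1ℚ + ι ℓ - half    ≡⟨ cong (_- half) (ι-suc ℓ) ⟨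
      ι (suc ℓ) - half   ∎)))

  ∣ρ₀∣≤ : ∀ r n → ∣ ρ0 r n ∣ ≤ ι 1280 * ι (suc n) * norm₁ r n
  ∣ρ₀∣≤ r n = begin
    ∣ - Σ< 4 (λ j → Σ< (suc n) (S j)) ∣                  ≡⟨ ∣-p∣≡∣p∣ (Σ< 4 (λ j → Σ< (suc n) (S j))) ⟩
    ∣ Σ< 4 (λ j → Σ< (suc n) (S j)) ∣                    ≤⟨ ∣Σ<∣≤Σ<∣∣ 4 (λ j → Σ< (suc n) (S j)) ⟩
    Σ< 4 (λ j → ∣ Σ< (suc n) (S j) ∣)                    ≤⟨ Σ<-mono-≤ 4 (λ j j<4 → ≤-trans (∣Σ<∣≤Σ<∣∣ (suc n) (S j))
                                                              (Σ<-mono-≤ (suc n) (∣S∣≤ j j<4))) ⟩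
    Σ< 4 (λ j → Σ< (suc n) (λ k → c * ∣ r (suc j) k ∣))  ≡⟨ norm₁-scale c r n ⟩
    c * norm₁ r n                                        ∎
    where
    open ≤-Reasoning
    c = ι 1280 * ι (suc n)
    F : ℕ → ℕ → ℕ → ℚ
    F j k ℓ = ι (suc j ℕ.* (suc j ℕ.+ 1)) * r (suc j) k * inv ((ι (suc ℓ) - half) ^ℚ (suc j ℕ.+ 2))
    S : ℕ → ℕ → ℚ
    S j k = Σ< k (F j k)
    ∣S∣≤ : ∀ j → j ℕ.< 4 → ∀ k → k ℕ.< suc n → ∣ S j k ∣ ≤ c * ∣ r (suc j) k ∣
    ∣S∣≤ j j<4 k k<1+n = begin
      ∣ Σ< k (F j k) ∣                   ≤⟨ ∣Σ<∣≤Σ<∣∣ k (F j k) ⟩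
      Σ< k (λ ℓ → ∣ F j k ℓ ∣)           ≤⟨ Σ<-mono-≤ k (λ ℓ _ → ∣ρ₀-term∣≤ (suc j) j<4 (r (suc j) k) ℓ) ⟩
      Σ< k (λ _ → x)                     ≡⟨ Σ<-const k x ⟩
      ι k * x                            ≤⟨ *-monoʳ-≤-nonNeg x {{nonNegative (*-nonNeg (ι-nonNeg 1280) (0≤∣p∣ (r (suc j) k)))}}
                                              (ι-mono-≤ (ℕP.<⇒≤ k<1+n)) ⟩
      ι (suc n) * x                      ≡⟨ *-exchangeˡ (ι (suc n)) (ι 1280) ∣ r (suc j) k ∣ ⟩
      ι 1280 * (ι (suc n) * ∣ r (suc j) k ∣)  ≡⟨ *-assoc (ι 1280) (ι (suc n)) ∣ r (suc j) k ∣ ⟨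
      c * ∣ r (suc j) k ∣                ∎
      where
      x = ι 1280 * ∣ r (suc j) k ∣

  ∣ρ₃∣≤ : ∀ r n → ∣ ρ3 r n ∣ ≤ ι 1280 * ι (suc n) * norm₁ r n
  ∣ρ₃∣≤ r n = begin
    ∣ ι 384 * Σ< (suc n) (r 3) ∣       ≡⟨ ∣ι*p∣≡ι*∣p∣ 384 (Σ< (suc n) (r 3)) ⟩
    ι 384 * ∣ Σ< (suc n) (r 3) ∣       ≤⟨ *-monoˡ-≤-nonNeg (ι 384) (≤-trans (∣Σ<∣≤Σ<∣∣ (suc n) (r 3)) Σ∣r₃∣≤norm₁) ⟩
    ι 384 * norm₁ r n                  ≤⟨ *-monoʳ-≤-nonNeg (norm₁ r n) {{nonNegative (norm₁-nonNeg r n)}} 384≤1280[1+n] ⟩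
    ι 1280 * ι (suc n) * norm₁ r n     ∎
    where
    open ≤-Reasoning
    Σ∣r₃∣≤norm₁ : Σ< (suc n) (λ k → ∣ r 3 k ∣) ≤ norm₁ r n
    Σ∣r₃∣≤norm₁ = Σ<-term≤ 4 (λ j _ → Σ<-nonNeg (suc n) (λ k _ → 0≤∣p∣ (r (suc j) k))) (ℕ.s≤s (ℕ.s≤s (ℕ.s≤s ℕ.z≤n)))
    384≤1280[1+n] : ι 384 ≤ ι 1280 * ι (suc n)
    384≤1280[1+n] = ≤-trans (ι-mono-≤ (ℕP.≤-trans (ℕP.≤ᵇ⇒≤ 384 1280 _) (ℕP.m≤m*n 1280 (suc n))))
                            (≤-reflexive (ι-* 1280 (suc n)))

  -- 1280 from ∣ρ₀∣≤ and 4096³ · 16 · 3 from norm₁-bound.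
  ρ-constant : ℕ
  ρ-constant = 1280 ℕ.* 4096 ℕ.^ 3 ℕ.* 48

  max∣ρ∣≤ : ∀ n r → IsPartialFractionOfR n r →
    ∣ ρ0 r n ∣ ⊔ ∣ ρ3 r n ∣ ≤ ι (ρ-constant ℕ.* suc n ℕ.^ 6 ℕ.* 2 ℕ.^ (8 ℕ.* n))
  max∣ρ∣≤ n r pf = begin
    ∣ ρ0 r n ∣ ⊔ ∣ ρ3 r n ∣
      ≤⟨ ⊔-lub (∣ρ₀∣≤ r n) (∣ρ₃∣≤ r n) ⟩
    ι 1280 * s * norm₁ r n
      ≤⟨ *-monoˡ-≤-nonNeg (ι 1280 * s) {{nonNegative (*-nonNeg (ι-nonNeg 1280) (ι-nonNeg (suc n)))}} (norm₁-bound n r pf) ⟩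
    ι 1280 * s * (ι (4096 ℕ.* suc n) ^ℚ 3 * (ι 16 * s * (P * ι (3 ℕ.* suc n))))
      ≡⟨ cong₂ (λ u v → ι 1280 * s * (u ^ℚ 3 * (ι 16 * s * (P * v)))) (ι-* 4096 (suc n)) (ι-* 3 (suc n)) ⟩
    ι 1280 * s * ((ι 4096 * s) ^ℚ 3 * (ι 16 * s * (P * (ι 3 * s))))
      ≡⟨ solve 2 (λ s P → con (ι 1280) :* s :* ((con (ι 4096) :* s) :^ 3 :* (con (ι 16) :* s :* (P :* (con (ι 3) :* s))))
                          := con (ι ρ-constant) :* s :^ 6 :* P) refl s P ⟩
    ι ρ-constant * s ^ℚ 6 * P
      ≡⟨ cong₂ _*_ (cong (ι ρ-constant *_) (ι-^ (suc n) 6)) (ι-^ 2 (8 ℕ.* n)) ⟨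
    ι ρ-constant * ι (suc n ℕ.^ 6) * ι (2 ℕ.^ (8 ℕ.* n))
      ≡⟨ cong (_* ι (2 ℕ.^ (8 ℕ.* n))) (ι-* ρ-constant (suc n ℕ.^ 6)) ⟨
    ι (ρ-constant ℕ.* suc n ℕ.^ 6) * ι (2 ℕ.^ (8 ℕ.* n))
      ≡⟨ ι-* (ρ-constant ℕ.* suc n ℕ.^ 6) (2 ℕ.^ (8 ℕ.* n)) ⟨
    ι (ρ-constant ℕ.* suc n ℕ.^ 6 ℕ.* 2 ℕ.^ (8 ℕ.* n))
      ∎
    where
    open ≤-Reasoning
    s = ι (suc n)
    P = ι 2 ^ℚ (8 ℕ.* n)

open Growth using (eventually-[poly*2^cn]^p≤2^[cp+1]n)
open Estimates using (ρ-constant; max∣ρ∣≤; ι-^; ι-mono-≤; ^ℚ-mono-≤)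

open import Data.Nat using (ℕ; suc; _*_; _+_; _^_) renaming (_≤_ to _≤ℕ_)
open import Data.Rational using (ℚ; _≤_; ∣_∣; _⊔_)
open import Data.Product using (∃-syntax; _,_; proj₁; proj₂)
open import Data.Rational.Properties using (≤-trans; 0≤∣p∣; p≤p⊔q; module ≤-Reasoning)
open import Relation.Binary.PropositionalEquality using (sym)

lemma6p1 : (r : ℕ → ℕ → ℕ → ℚ) → (∀ n → IsPartialFractionOfR n (r n)) →
    ∀ (m : ℕ) → ∃[ N ] (∀ n → N ≤ℕ n →
      (∣ ρ0 (r n) n ∣ ⊔ ∣ ρ3 (r n) n ∣) ^ℚ suc m ≤ ι 2 ^ℚ ((8 * suc m + 1) * n))
lemma6p1 r pf m = proj₁ growth , λ n N≤n → begin
  (∣ ρ0 (r n) n ∣ ⊔ ∣ ρ3 (r n) n ∣) ^ℚ suc m   ≤⟨ ^ℚ-mono-≤ (suc m) (≤-trans (0≤∣p∣ (ρ0 (r n) n)) (p≤p⊔q _ _))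
                                                              (max∣ρ∣≤ n (r n) (pf n)) ⟩
  ι (K n) ^ℚ suc m                              ≡⟨ sym (ι-^ (K n) (suc m)) ⟩
  ι (K n ^ suc m)                               ≤⟨ ι-mono-≤ (proj₂ growth n N≤n) ⟩
  ι (2 ^ ((8 * suc m + 1) * n))                 ≡⟨ ι-^ 2 ((8 * suc m + 1) * n) ⟩
  ι 2 ^ℚ ((8 * suc m + 1) * n)                  ∎
  where
  open ≤-Reasoning
  K : ℕ → ℕ
  K n = ρ-constant * suc n ^ 6 * 2 ^ (8 * n)
  growth : ∃[ N ] (∀ n → N ≤ℕ n → K n ^ suc m ≤ℕ 2 ^ ((8 * suc m + 1) * n))
  growth = eventually-[poly*2^cn]^p≤2^[cp+1]n ρ-constant 6 8 (suc m)
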